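{- Define the sequence $c$ by $c(1)=2$ and, for $n\ge 2$, $$c(n)=c(n-1)+\begin{cases}\gcd(n,\,c(n-1)), & n \text{ even},\\ \gcd(n-2,\,c(n-1)), & n\text{ odd}.\end{cases}$$ Call $n$ a fundamental point if $c(n)=2n$. Let $6\le m_j<m_{j+1}$ be adjacent fundamental points (no fundamental point lies strictly between them) such that the only integer $n$ with $m_j<n<m_{j+1}$ and $c(n)-c(n-1)>1$ is $n=m_j+3$ (the main increment). Then (i) $m_{j+1}=2m_j$; (ii) if $m_j-1$ and $m_j+1$ are twin primes, then $m_{j+1}-1$ and $m_{j+1}+1$ are twin primes as well.
   Context: The increment $c(m_j+3)-c(m_j+2)$ at a fundamental point $m_j$ is called the main increment. -}

module Defs where

open import Data.Nat using (ℕ; zero; suc; _+_; _*_; _∸_; _<_; _≤_)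
open import Data.Nat.GCD using (gcd)
open import Data.Nat.DivMod using (_%_)
open import Data.Bool using (if_then_else_)
open import Data.Nat using (_≡ᵇ_)

-- c n for n ≥ 1; c 0 is an unused placeholder (set to 0).
-- c 1 = 2, and for n ≥ 2:
--   c n = c (n-1) + gcd n (c (n-1))       if n even
--   c n = c (n-1) + gcd (n-2) (c (n-1))   if n odd
c : ℕ → ℕ
c zero = 0
c (suc zero) = 2
c (suc (suc k)) =
  let n = suc (suc k) ; p = c (suc k) in
  p + (if (n % 2) ≡ᵇ 0 then gcd n p else gcd k p)

FundamentalPoint : ℕ → Set
FundamentalPoint n = 1 ≤ n × c n ≡ 2 * n
  where
  open import Data.Product using (_×_)
  open import Relation.Binary.PropositionalEquality using (_≡_)

module Submission where

-- Every step n of the recurrence adds gcd(a, c(n-1)), where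
-- a = n or a = n-2 according to the parity of n; the increment is therefore at
-- least 1, and it is larger than 1 as soon as a and c(n-1) share a divisor ≥ 2.
--
-- At m the step m+1 being a unit step forces m to be even (otherwise 2 divides
-- both m+1 and c(m) = 2m).  Two unit steps give c(m+2) = 2m+2, the main increment
-- adds gcd(m+1, 2m+2) = m+1, and from then on c(n) = 2m + n.  Comparing with
-- c(m′) = 2m′ gives m′ ≥ 2m, while 2m < m′ would make 2m fundamental: (i).
--
-- For (ii), on the linear stretch c(n) = 2m + n, m+3 ≤ n < 2m, write m = 2t.
-- An odd divisor d < t of 2m-1 divides the even step n = 2m-1-d and c(n-1),
-- an odd divisor d < t of 2m+1 divides n-2 and c(n-1) for the odd step
-- n = 2m+3-2d; both steps lie in the stretch, so both would be large.  Hence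
-- 2m±1 are t-rough and below t², i.e. prime, when t ≥ 5; m = 6 is checked
-- directly and m = 8 is excluded by the hypothesis (9 is not prime).

open import Defs
open import Data.Bool using (true; false; if_then_else_)
open import Data.Empty using (⊥; ⊥-elim)
open import Data.Nat
open import Data.Nat.Divisibility
open import Data.Nat.DivMod
open import Data.Nat.GCD
open import Data.Nat.Primality
open import Data.Nat.Properties
open import Data.Nat.Tactic.RingSolver using (solve-∀)
open import Data.Product using (_×_; _,_; ∃)
open import Data.Sum using (inj₂)
open import Relation.Binary.PropositionalEquality
open import Relation.Nullary using (¬_)
open import Relation.Nullary.Decidable using (from-yes; from-no)

≤-by-difference : ∀ {a b} j → a + j ≡ b → a ≤ b
≤-by-difference j eq = subst (_ ≤_) eq (m≤m+n _ j)

c-positive : ∀ k → 1 ≤ c (suc k)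
c-positive zero    = s≤s z≤n
c-positive (suc k) = ≤-trans (c-positive k) (m≤m+n _ _)

gcd-positive : ∀ a {p} → 1 ≤ p → 1 ≤ gcd a p
gcd-positive a {suc p} _ = n≢0⇒n>0 (gcd[m,n]≢0 a (suc p) (inj₂ λ ()))

step-even : ∀ k → (2 + k) % 2 ≡ 0
          → c (2 + k) ≡ c (1 + k) + gcd (2 + k) (c (1 + k))
step-even k even =
  cong (λ b → c (1 + k) + (if b then gcd (2 + k) (c (1 + k)) else gcd k (c (1 + k))))
       (cong (_≡ᵇ 0) even)

step-odd : ∀ k → (2 + k) % 2 ≡ 1
         → c (2 + k) ≡ c (1 + k) + gcd k (c (1 + k))
step-odd k odd =
  cong (λ b → c (1 + k) + (if b then gcd (2 + k) (c (1 + k)) else gcd k (c (1 + k))))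
       (cong (_≡ᵇ 0) odd)

c-increasing : ∀ n → 1 ≤ n → c n < c (suc n)
c-increasing (suc k) _ = grows ((2 + k) % 2 ≡ᵇ 0)
  where
  p = c (1 + k)
  grows : ∀ b → p < p + (if b then gcd (2 + k) p else gcd k p)
  grows true  = m<m+n p (gcd-positive (2 + k) (c-positive k))
  grows false = m<m+n p (gcd-positive k (c-positive k))

large-increment : ∀ k a x → c (2 + k) ≡ c (1 + k) + gcd a (c (1 + k))
                → 2 ≤ x → x ∣ a → x ∣ c (1 + k) → 1 < c (2 + k) ∸ c (1 + k)
large-increment k a x step 2≤x x∣a x∣p = begin-strict
  1                 <⟨ 2≤x ⟩
  x                 ≤⟨ ∣⇒≤ {{>-nonZero (gcd-positive a (c-positive k))}} (gcd-greatest x∣a x∣p) ⟩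
  gcd a p           ≡⟨ sym (m+n∸m≡n p (gcd a p)) ⟩
  p + gcd a p ∸ p   ≡⟨ cong (_∸ p) (sym step) ⟩
  c (2 + k) ∸ p     ∎
  where
  open ≤-Reasoning
  p = c (1 + k)

unit-increment : ∀ n → 1 ≤ n → ¬ (1 < c (suc n) ∸ c n) → c (suc n) ≡ suc (c n)
unit-increment n 1≤n not-large = ≤-antisym upper (c-increasing n 1≤n)
  where
  open ≤-Reasoning
  upper : c (suc n) ≤ suc (c n)
  upper = begin
    c (suc n)                     ≡⟨ sym (m+[n∸m]≡n (<⇒≤ (c-increasing n 1≤n))) ⟩
    c n + (c (suc n) ∸ c n)       ≤⟨ +-monoʳ-≤ (c n) (≮⇒≥ not-large) ⟩
    c n + 1                       ≡⟨ +-comm (c n) 1 ⟩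
    suc (c n)                     ∎

unit-not-large : ∀ {n} → c (suc n) ≡ suc (c n) → ¬ (1 < c (suc n) ∸ c n)
unit-not-large {n} unit large =
  <-irrefl refl (subst (1 <_) (trans (cong (_∸ c n) unit) (m+n∸n≡m 1 (c n))) large)

unit-run : ∀ a d → (∀ i → i < d → c (suc (a + i)) ≡ suc (c (a + i))) → c (a + d) ≡ c a + d
unit-run a zero    _     = trans (cong c (+-identityʳ a)) (sym (+-identityʳ (c a)))
unit-run a (suc d) steps = begin
  c (a + suc d)     ≡⟨ cong c (+-suc a d) ⟩
  c (suc (a + d))   ≡⟨ steps d (n<1+n d) ⟩
  suc (c (a + d))   ≡⟨ cong suc (unit-run a d (λ i i<d → steps i (m<n⇒m<1+n i<d))) ⟩
  suc (c a + d)     ≡⟨ sym (+-suc (c a) d) ⟩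
  c a + suc d       ∎
  where open ≡-Reasoning

-- A fundamental point followed by a unit step is even: for odd m the even
-- step m+1 has 2 dividing both m+1 and c(m) = 2m.
fundamental-parity : ∀ m → 1 ≤ m → c m ≡ 2 * m → c (suc m) ≡ suc (c m) → m % 2 ≡ 0
fundamental-parity (suc k) _ cm unit with (1 + k) % 2 in parity | m%n<n (1 + k) 2
... | 0           | _               = refl
... | 1           | _               = ⊥-elim (unit-not-large {1 + k} unit
      (large-increment k (2 + k) 2 (step-even k next-even) ≤-refl
        (m%n≡0⇒n∣m (2 + k) 2 next-even) (subst (2 ∣_) (sym cm) (m∣m*n (1 + k)))))
  where
  next-even : (2 + k) % 2 ≡ 0
  next-even = trans (%-distribˡ-+ 1 (1 + k) 2) (cong (λ r → (1 + r) % 2) parity)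
... | suc (suc _) | s≤s (s≤s ())

-- The main increment: at even m with c(m+2) = 2m+2, the odd step m+3 adds
-- gcd(m+1, 2m+2) = m+1, so c(m+3) = 2m + (m+3).
main-increment : ∀ m → m % 2 ≡ 0 → c (m + 2) ≡ 2 * m + 2 → c (m + 3) ≡ 2 * m + (m + 3)
main-increment m even c-m+2 = begin
  c (m + 3)                                 ≡⟨ cong c (+-comm m 3) ⟩
  c (3 + m)                                 ≡⟨ step-odd (1 + m) odd ⟩
  c (2 + m) + gcd (1 + m) (c (2 + m))       ≡⟨ cong (λ x → x + gcd (1 + m) x) c-2+m ⟩
  (2 * m + 2) + gcd (1 + m) (2 * m + 2)     ≡⟨ cong ((2 * m + 2) +_) gcd-double ⟩
  (2 * m + 2) + (1 + m)                     ≡⟨ rearrange m ⟩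
  2 * m + (m + 3)                           ∎
  where
  open ≡-Reasoning
  odd : (3 + m) % 2 ≡ 1
  odd = trans (%-distribˡ-+ 3 m 2) (cong (λ r → (1 + r) % 2) even)
  c-2+m : c (2 + m) ≡ 2 * m + 2
  c-2+m = trans (cong c (+-comm 2 m)) c-m+2
  double : ∀ m → 2 * m + 2 ≡ 2 * (1 + m)
  double = solve-∀
  gcd-double : gcd (1 + m) (2 * m + 2) ≡ 1 + m
  gcd-double = ∣-antisym (gcd[m,n]∣m (1 + m) (2 * m + 2))
                         (gcd-greatest ∣-refl (divides 2 (double m)))
  rearrange : ∀ m → (2 * m + 2) + (1 + m) ≡ 2 * m + (m + 3)
  rearrange = solve-∀

Linear : ℕ → Set
Linear m = ∀ n → m + 3 ≤ n → n < 2 * m → c n ≡ 2 * m + n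

linear-not-large : ∀ {m k} → Linear m → m + 3 ≤ suc k → 2 + k < 2 * m
                 → ¬ (1 < c (2 + k) ∸ c (1 + k))
linear-not-large {m} {k} lin le lt = unit-not-large {1 + k} (begin
  c (2 + k)           ≡⟨ lin (2 + k) (≤-trans le (n≤1+n _)) lt ⟩
  2 * m + (2 + k)     ≡⟨ +-suc (2 * m) (1 + k) ⟩
  suc (2 * m + (1 + k)) ≡⟨ cong suc (sym (lin (1 + k) le (<-trans (n<1+n _) lt))) ⟩
  suc (c (1 + k))     ∎)
  where open ≡-Reasoning

-- An even step n of the stretch cannot share a divisor d ≥ 2 with 2m-1,
-- because d would also divide c(n-1) = (2m-1) + n.
even-obstruction : ∀ {m k d} → Linear m → m + 3 ≤ suc k → 2 + k < 2 * m
                 → (2 + k) % 2 ≡ 0 → 2 ≤ d → d ∣ 2 + k → d ∣ 2 * m ∸ 1 → ⊥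
even-obstruction {m} {k} {d} lin le lt even 2≤d d∣n d∣N =
  linear-not-large {m} {k} lin le lt (large-increment k (2 + k) d (step-even k even) 2≤d d∣n d∣c)
  where
  open ≡-Reasoning
  split : 2 * m ∸ 1 + (2 + k) ≡ c (1 + k)
  split = begin
    2 * m ∸ 1 + (1 + (1 + k))   ≡⟨ sym (+-assoc (2 * m ∸ 1) 1 (1 + k)) ⟩
    2 * m ∸ 1 + 1 + (1 + k)     ≡⟨ cong (_+ (1 + k)) (m∸n+n≡m (≤-trans (s≤s z≤n) lt)) ⟩
    2 * m + (1 + k)             ≡⟨ sym (lin (1 + k) le (<-trans (n<1+n _) lt)) ⟩
    c (1 + k)                   ∎
  d∣c : d ∣ c (1 + k)
  d∣c = subst (d ∣_) split (∣m∣n⇒∣m+n d∣N d∣n)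

-- An odd step n of the stretch cannot have n-2 share a divisor d ≥ 2 with
-- 2m+1, because d would also divide c(n-1) = (2m+1) + (n-2).
odd-obstruction : ∀ {m k d} → Linear m → m + 3 ≤ suc k → 2 + k < 2 * m
                → (2 + k) % 2 ≡ 1 → 2 ≤ d → d ∣ k → d ∣ 2 * m + 1 → ⊥
odd-obstruction {m} {k} {d} lin le lt odd 2≤d d∣k d∣N =
  linear-not-large {m} {k} lin le lt (large-increment k k d (step-odd k odd) 2≤d d∣k d∣c)
  where
  split : 2 * m + 1 + k ≡ c (1 + k)
  split = trans (+-assoc (2 * m) 1 k) (sym (lin (1 + k) le (<-trans (n<1+n _) lt)))
  d∣c : d ∣ c (1 + k)
  d∣c = subst (d ∣_) split (∣m∣n⇒∣m+n d∣N d∣k)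

odd-divisor : ∀ d y → d ∣ 1 + y * 2 → ∃ λ h → d ≡ 1 + h * 2
odd-divisor d y d∣N with d % 2 | m≡m%n+[m/n]*n d 2 | m%n<n d 2
... | 0           | d≡ | _ = ⊥-elim (1+n≢n (∣1⇒≡1 2∣1))
  where
  2∣1 : 2 ∣ 1
  2∣1 = ∣m+n∣m⇒∣n (subst (2 ∣_) (+-comm 1 (y * 2)) (∣-trans (divides (d / 2) d≡) d∣N))
                   (n∣m*n y)
... | 1           | d≡ | _ = d / 2 , d≡
... | suc (suc _) | _  | s≤s (s≤s ())

small-odd-divisor : ∀ {d t} y → 1 < d → d < t → d ∣ 1 + y * 2
                  → ∃ λ e → ∃ λ r → d ≡ 3 + e * 2 × t ≡ 4 + e * 2 + r
small-odd-divisor {d} {t} y 1<d d<t d∣N with odd-divisor d y d∣N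
... | zero  , refl = ⊥-elim (<-irrefl refl 1<d)
... | suc e , refl with m≤n⇒∃[o]m+o≡n d<t
...   | r , t≡ = e , r , refl , sym t≡

-- With m = 2t and d = 2e+3 < t: the even step n = 2m-1-d lies in the stretch,
-- and d ∣ 2m-1 = d + n gives d ∣ n, which the stretch forbids.
minus-obstruction : ∀ e r → Linear ((4 + e * 2 + r) * 2)
                  → ¬ (3 + e * 2 ∣ 2 * ((4 + e * 2 + r) * 2) ∸ 1)
minus-obstruction e r lin d∣N =
  even-obstruction {m = (4 + e * 2 + r) * 2} {k = 10 + e * 6 + r * 4} lin
    (≤-by-difference (e * 2 + r * 2) (low e r)) (≤-by-difference (3 + e * 2) (high e r))
    (subst (λ n → n % 2 ≡ 0) (sym (halve e r)) (m*n%n≡0 (6 + e * 3 + r * 2) 2))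
    (s≤s (s≤s z≤n)) (∣m+n∣m⇒∣n (subst (3 + e * 2 ∣_) (cong (_∸ 1) (split e r)) d∣N) ∣-refl) d∣N
  where
  low : ∀ e r → (4 + e * 2 + r) * 2 + 3 + (e * 2 + r * 2) ≡ 11 + e * 6 + r * 4
  low = solve-∀
  high : ∀ e r → 13 + e * 6 + r * 4 + (3 + e * 2) ≡ 2 * ((4 + e * 2 + r) * 2)
  high = solve-∀
  halve : ∀ e r → 12 + e * 6 + r * 4 ≡ (6 + e * 3 + r * 2) * 2
  halve = solve-∀
  split : ∀ e r → 2 * ((4 + e * 2 + r) * 2) ≡ 1 + ((3 + e * 2) + (12 + e * 6 + r * 4))
  split = solve-∀

-- With m = 2t and d = 2e+3 < t: the odd step n = 2m+3-2d lies in the stretch,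
-- and d ∣ 2m+1 = 2d + (n-2) gives d ∣ n-2, which the stretch forbids.
plus-obstruction : ∀ e r → Linear ((4 + e * 2 + r) * 2)
                 → ¬ (3 + e * 2 ∣ 2 * ((4 + e * 2 + r) * 2) + 1)
plus-obstruction e r lin d∣N =
  odd-obstruction {m = (4 + e * 2 + r) * 2} {k = 11 + e * 4 + r * 4} lin
    (≤-by-difference (1 + r * 2) (low e r)) (≤-by-difference (2 + e * 4) (high e r))
    (subst (λ n → n % 2 ≡ 1) (sym (halve e r)) ([m+kn]%n≡m%n 1 (6 + e * 2 + r * 2) 2))
    (s≤s (s≤s z≤n)) (∣m+n∣m⇒∣n (subst (3 + e * 2 ∣_) (split e r) d∣N) (m∣m*n 2)) d∣N
  where
  low : ∀ e r → (4 + e * 2 + r) * 2 + 3 + (1 + r * 2) ≡ 12 + e * 4 + r * 4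
  low = solve-∀
  high : ∀ e r → 14 + e * 4 + r * 4 + (2 + e * 4) ≡ 2 * ((4 + e * 2 + r) * 2)
  high = solve-∀
  halve : ∀ e r → 13 + e * 4 + r * 4 ≡ 1 + (6 + e * 2 + r * 2) * 2
  halve = solve-∀
  split : ∀ e r → 2 * ((4 + e * 2 + r) * 2) + 1 ≡ (3 + e * 2) * 2 + (11 + e * 4 + r * 4)
  split = solve-∀

rough-minus : ∀ t → Linear (t * 2) → t Rough (2 * (t * 2) ∸ 1)
rough-minus zero    _   (hasNonTrivialDivisor () _)
rough-minus (suc t) lin (hasNonTrivialDivisor {d} d<t d∣N)
  with small-odd-divisor (1 + t * 2) (nonTrivial⇒n>1 d) d<t (subst (d ∣_) (cong (_∸ 1) (odd t)) d∣N)
  where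
  odd : ∀ t → 2 * (suc t * 2) ≡ 2 + (1 + t * 2) * 2
  odd = solve-∀
... | e , r , refl , refl = minus-obstruction e r lin d∣N

rough-plus : ∀ t → Linear (t * 2) → t Rough (2 * (t * 2) + 1)
rough-plus t lin (hasNonTrivialDivisor {d} d<t d∣N)
  with small-odd-divisor (t * 2) (nonTrivial⇒n>1 d) d<t (subst (d ∣_) (odd t) d∣N)
  where
  odd : ∀ t → 2 * (t * 2) + 1 ≡ 1 + (t * 2) * 2
  odd = solve-∀
... | e , r , refl , refl = plus-obstruction e r lin d∣N

-- For m = 2t with t = u + 5 ≥ 5 a linear stretch makes 2m ± 1 prime:
-- they are t-rough and smaller than t².
linear-twin-primes : ∀ u → Linear ((5 + u) * 2)
                   → Prime (2 * ((5 + u) * 2) ∸ 1) × Prime (2 * ((5 + u) * 2) + 1)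
linear-twin-primes u lin =
    rough∧square>⇒prime (rough-minus (5 + u) lin) (≤-<-trans (m∸n≤m (2 * ((5 + u) * 2)) 1) (<-trans (m<m+n _ (s≤s z≤n)) square))
  , rough∧square>⇒prime (rough-plus (5 + u) lin) square
  where
  expand : ∀ u → suc (2 * ((5 + u) * 2) + 1) + (3 + u * 6 + u * u) ≡ (5 + u) * (5 + u)
  expand = solve-∀
  square : 2 * ((5 + u) * 2) + 1 < (5 + u) * (5 + u)
  square = ≤-by-difference (3 + u * 6 + u * u) (expand u)

-- The twin prime transfer for even m ≥ 6 with a linear stretch [m+3, 2m).
-- For m = 6 both 11 and 13 are prime; m = 8 is impossible since 9 is not prime.
twin-primes-double : ∀ {m} t → m ≡ t * 2 → 6 ≤ m → Linear m
                   → Prime (m ∸ 1) → Prime (m + 1) → Prime (2 * m ∸ 1) × Prime (2 * m + 1)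
twin-primes-double 0 refl () _ _ _
twin-primes-double 1 refl (s≤s (s≤s ())) _ _ _
twin-primes-double 2 refl (s≤s (s≤s (s≤s (s≤s ())))) _ _ _
twin-primes-double 3 refl _ _ _ _  = from-yes (prime? 11) , from-yes (prime? 13)
twin-primes-double 4 refl _ _ _ p9 = ⊥-elim (from-no (prime? 9) p9)
twin-primes-double (suc (suc (suc (suc (suc u))))) refl _ lin _ _ = linear-twin-primes u lin

even-half : ∀ {m} → m % 2 ≡ 0 → m ≡ (m / 2) * 2
even-half {m} even = trans (m≡m%n+[m/n]*n m 2) (cong (_+ (m / 2) * 2) even)

-- From c(p) = 2m + p < c(p+1) = 2(p+1) one gets 2m ≤ p + 1.
double-bound : ∀ a p → a + p < 2 * suc p → a ≤ suc p
double-bound a p lt = ≤-pred (+-cancelʳ-< p a (2 + p) (subst (a + p <_) (split p) lt))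
  where
  split : ∀ p → 2 * suc p ≡ 2 + p + p
  split = solve-∀

module Gap (m m′ : ℕ) (6≤m : 6 ≤ m) (c-m : c m ≡ 2 * m) (c-m′ : c m′ ≡ 2 * m′)
           (adjacent : ∀ n → m < n → n < m′ → ¬ FundamentalPoint n)
           (m+3<m′ : m + 3 < m′)
           (only-main : ∀ n → m < n → n < m′ → 1 < c n ∸ c (n ∸ 1) → n ≡ m + 3) where

  1≤m : 1 ≤ m
  1≤m = ≤-trans (s≤s z≤n) 6≤m

  unit-step : ∀ j → m ≤ j → suc j < m′ → suc j ≢ m + 3 → c (suc j) ≡ suc (c j)
  unit-step j m≤j lt not-main =
    unit-increment j (≤-trans 1≤m m≤j) (λ large → not-main (only-main (suc j) (s≤s m≤j) lt large))

  early-step : ∀ i → i < 2 → c (suc (m + i)) ≡ suc (c (m + i))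
  early-step i i<2 = unit-step (m + i) (m≤m+n m i) (<-trans before m+3<m′) (<⇒≢ before)
    where
    before : suc (m + i) < m + 3
    before = subst (_< m + 3) (+-suc m i) (+-monoʳ-< m (s≤s i<2))

  m-even : m % 2 ≡ 0
  m-even = fundamental-parity m 1≤m c-m
    (subst (λ j → c (suc j) ≡ suc (c j)) (+-identityʳ m) (early-step 0 (s≤s z≤n)))

  c-m+3 : c (m + 3) ≡ 2 * m + (m + 3)
  c-m+3 = main-increment m m-even (trans (unit-run m 2 early-step) (cong (_+ 2) c-m))

  linear-run : ∀ i → m + 3 + i < m′ → c (m + 3 + i) ≡ 2 * m + (m + 3 + i)
  linear-run i lt = begin
    c (m + 3 + i)               ≡⟨ unit-run (m + 3) i later-step ⟩
    c (m + 3) + i               ≡⟨ cong (_+ i) c-m+3 ⟩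
    2 * m + (m + 3) + i         ≡⟨ +-assoc (2 * m) (m + 3) i ⟩
    2 * m + (m + 3 + i)         ∎
    where
    open ≡-Reasoning
    later-step : ∀ j → j < i → c (suc (m + 3 + j)) ≡ suc (c (m + 3 + j))
    later-step j j<i =
      unit-step (m + 3 + j) (≤-trans (m≤m+n m 3) (m≤m+n _ j))
        (≤-<-trans (subst (_≤ m + 3 + i) (+-suc (m + 3) j) (+-monoʳ-≤ (m + 3) j<i)) lt)
        (≢-sym (<⇒≢ (s≤s (m≤m+n (m + 3) j))))

  linear-below-m′ : ∀ n → m + 3 ≤ n → n < m′ → c n ≡ 2 * m + n
  linear-below-m′ n le lt with m≤n⇒∃[o]m+o≡n le
  ... | i , refl = linear-run i lt

  -- (i) c(m′) = 2m′ exceeds c(m′-1) = 2m + m′ - 1, so m′ ≥ 2m; and 2m < m′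
  -- would make 2m a fundamental point inside the gap.
  m′≡2m : m′ ≡ 2 * m
  m′≡2m = sym (≤∧≮⇒≡ lower not-above)
    where
    lower : 2 * m ≤ m′
    lower with m≤n⇒∃[o]m+o≡n m+3<m′
    ... | o , last≡ = subst (2 * m ≤_) last≡ (double-bound (2 * m) p (subst₂ _<_ c-p c-p+1 increase))
      where
      p = m + 3 + o
      increase : c p < c (suc p)
      increase = c-increasing p (≤-trans 1≤m (≤-trans (m≤m+n m 3) (m≤m+n _ o)))
      c-p : c p ≡ 2 * m + p
      c-p = linear-run o (subst (p <_) last≡ ≤-refl)
      c-p+1 : c (suc p) ≡ 2 * suc p
      c-p+1 = subst (λ n → c n ≡ 2 * n) (sym last≡) c-m′
    twice : ∀ n → n + n ≡ 2 * n
    twice = solve-∀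
    not-above : ¬ 2 * m < m′
    not-above lt = adjacent (2 * m) m<2m lt (≤-trans 1≤m (<⇒≤ m<2m) , c-2m)
      where
      m<2m : m < 2 * m
      m<2m = subst (m <_) (twice m) (m<m+n m 1≤m)
      m+3≤2m : m + 3 ≤ 2 * m
      m+3≤2m = subst (m + 3 ≤_) (twice m) (+-monoʳ-≤ m (≤-trans (s≤s (s≤s (s≤s z≤n))) 6≤m))
      c-2m : c (2 * m) ≡ 2 * (2 * m)
      c-2m = trans (linear-below-m′ (2 * m) m+3≤2m lt) (twice (2 * m))

  stretch : Linear m
  stretch n le lt = linear-below-m′ n le (subst (n <_) (sym m′≡2m) lt)

theorem2 : (m m′ : ℕ) → 6 ≤ m → m < m′
    → FundamentalPoint m → FundamentalPoint m′
    → (∀ n → m < n → n < m′ → ¬ FundamentalPoint n)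
    → m + 3 < m′ → 1 < c (m + 3) ∸ c (m + 2)
    → (∀ n → m < n → n < m′ → 1 < c n ∸ c (n ∸ 1) → n ≡ m + 3)
    → (m′ ≡ 2 * m)
    × (Prime (m ∸ 1) → Prime (m + 1) → Prime (m′ ∸ 1) × Prime (m′ + 1))
theorem2 m m′ 6≤m _ (_ , c-m) (_ , c-m′) adjacent m+3<m′ _ only-main =
    m′≡2m
  , λ prime₋ prime₊ → subst (λ n → Prime (n ∸ 1) × Prime (n + 1)) (sym m′≡2m)
      (twin-primes-double (m / 2) (even-half m-even) 6≤m stretch prime₋ prime₊)
  where open Gap m m′ 6≤m c-m c-m′ adjacent m+3<m′ only-main
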